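{- Let $G$ be a strongly connected compressed directed graph that is not a closed path. Let $fWg$ be an omnitig of $G$ where $f$ is a join arc and $g$ is a split arc. (i) If $W$ is a join-free path (possibly empty), then for every split arc $g'\neq g$ with $t(g')=t(g)$, the walk $fWg'$ is not an omnitig. (ii) If $W$ is a split-free path (possibly empty), then for every join arc $f'\neq f$ with $h(f')=h(f)$, the walk $f'Wg$ is not an omnitig.
   Context: Graphs are finite directed multigraphs (parallel arcs and self-loops allowed); $t(e)$, $h(e)$ are tail and head of arc $e$. A path is a walk with distinct nodes except the last may equal the first. A closed path is a graph consisting of a single cycle. A node is a join node if its in-degree exceeds 1, a split node if its out-degree exceeds 1, biunivocal if neither. An arc $e$ is a join arc if $h(e)$ is a join node (else join-free), a split arc if $t(e)$ is a split node (else split-free), biunivocal if neither. A path is join-free (split-free) if all its arcs are. A graph is compressed if it has no biunivocal nodes and no biunivocal arcs. A walk $W=e_0\dots e_\ell$ is an omnitig if for all $1\le i\le j\le \ell$ there is no non-empty path from $t(e_j)$ to $h(e_{i-1})$ whose first arc differs from $e_j$ and whose last arc differs from $e_{i-1}$. -}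

module Defs where

open import Data.Nat using (ℕ; zero; suc; _<_; _∸_)
open import Data.Fin using (Fin; toℕ; _≟_)
open import Data.List using (List; []; _∷_; map; length; filter; allFin; lookup)
open import Data.List.Relation.Unary.All using (All)
open import Data.List.Membership.Propositional using (_∈_)
open import Data.Product using (Σ; ∃; _×_; _,_)
open import Data.Sum using (_⊎_)
open import Data.Empty using (⊥)
open import Data.Unit using (⊤)
open import Relation.Nullary using (¬_)
open import Relation.Binary.PropositionalEquality using (_≡_; _≢_)

record Graph : Set where
  field
    nV nE : ℕ
    t h   : Fin nE → Fin nV

module _ (G : Graph) where
  open Graph G

  Node = Fin nV
  Arc  = Fin nE

  inDeg : Node → ℕ
  inDeg v = length (filter (λ e → h e ≟ v) (allFin nE))

  outDeg : Node → ℕ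
  outDeg v = length (filter (λ e → t e ≟ v) (allFin nE))

  JoinNode SplitNode BiunivocalNode : Node → Set
  JoinNode v = 1 < inDeg v
  SplitNode v = 1 < outDeg v
  BiunivocalNode v = ¬ JoinNode v × ¬ SplitNode v

  JoinArc SplitArc JoinFree SplitFree BiunivocalArc : Arc → Set
  JoinArc e = JoinNode (h e)
  SplitArc e = SplitNode (t e)
  JoinFree e = ¬ JoinArc e
  SplitFree e = ¬ SplitArc e
  BiunivocalArc e = ¬ JoinArc e × ¬ SplitArc e

  IsWalk : List Arc → Set
  IsWalk [] = ⊤
  IsWalk (e ∷ []) = ⊤
  IsWalk (e ∷ e' ∷ es) = h e ≡ t e' × IsWalk (e' ∷ es)

  walkNodes : List Arc → List Node
  walkNodes [] = []
  walkNodes (e ∷ es) = t e ∷ map h (e ∷ es)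

  DistinctExceptEnds : List Node → Set
  DistinctExceptEnds ns =
    (i j : Fin (length ns)) → toℕ i < toℕ j → lookup ns i ≡ lookup ns j →
    toℕ i ≡ 0 × toℕ j ≡ length ns ∸ 1

  IsPath : List Arc → Set
  IsPath W = IsWalk W × DistinctExceptEnds (walkNodes W)

  lastArc : Arc → List Arc → Arc
  lastArc e [] = e
  lastArc e (e' ∷ es) = lastArc e' es

  AvoidingPath : Node → Node → Arc → Arc → Set
  AvoidingPath u v a b =
    Σ Arc λ e → Σ (List Arc) λ es →
      IsPath (e ∷ es) × t e ≡ u × h (lastArc e es) ≡ v × e ≢ a × lastArc e es ≢ b

  -- W = e₀ … e_ℓ is an omnitig: for all 1 ≤ i ≤ j ≤ ℓ there is no non-empty path from
  -- t(e_j) to h(e_{i-1}) with first arc ≠ e_j and last arc ≠ e_{i-1}.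
  -- Here a = i-1 and b = j, so 1 ≤ i ≤ j ≤ ℓ becomes a < b.
  IsOmnitig : List Arc → Set
  IsOmnitig W = IsWalk W ×
    ((a b : Fin (length W)) → toℕ a < toℕ b →
      ¬ AvoidingPath (t (lookup W b)) (h (lookup W a)) (lookup W b) (lookup W a))

  Reachable : Node → Node → Set
  Reachable u v = u ≡ v ⊎
    (Σ Arc λ e → Σ (List Arc) λ es → IsWalk (e ∷ es) × t e ≡ u × h (lastArc e es) ≡ v)

  StronglyConnected : Set
  StronglyConnected = (u v : Node) → Reachable u v

  Compressed : Set
  Compressed = ((v : Node) → ¬ BiunivocalNode v) × ((e : Arc) → ¬ BiunivocalArc e)

  IsClosedPath : Set
  IsClosedPath =
    Σ Arc λ e → Σ (List Arc) λ es →
      IsPath (e ∷ es) × h (lastArc e es) ≡ t e ×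
      ((x : Arc) → x ∈ (e ∷ es)) × ((v : Node) → v ∈ walkNodes (e ∷ es))

-- For (i), let u = h f and v = t g. As f is a join arc, u has a second in-arc f₂, and strong
-- connectivity closes f₂ into a simple closed walk C at u ending with f₂. Follow C and W from u
-- side by side. If they part where W takes an arc e, the rest of C is a path from t e to u that
-- starts off e and ends with f₂ ≠ f, which the omnitig f W g forbids; and the path W cannot run
-- through the whole of C and go on. So W is a prefix of C, and the rest of C is a path from v to u
-- ending with f₂ ≠ f. Its first arc differs from g or from g′, and since t g′ = t g it contradicts
-- that f W g or f W g′ is an omnitig. Part (ii) is the mirror image: a simple closed walk at v
-- leaving by a sibling g₂ of g is compared with W from the end.
module Submission where

open import Defs
open import Data.Empty using (⊥; ⊥-elim)
open import Data.Fin using (Fin; toℕ; zero; suc; _≟_)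
open import Data.List using (List; []; _∷_; _++_; _∷ʳ_; map; length; lookup; reverse; filter; allFin)
open import Data.List.Membership.Propositional using (_∈_)
open import Data.List.Membership.Propositional.Properties using (∈-lookup; ∈-++⁻; ∈-filter⁻)
open import Data.List.Properties
  using (++-assoc; ++-identityʳ; ++-conicalʳ; ∷-injectiveˡ; ∷-injectiveʳ; ∷ʳ-++; map-++; length-++;
         reverse-++; reverse-involutive; unfold-reverse)
open import Data.List.Relation.Binary.Permutation.Propositional using (↭⇒↭ₛ; ↭-sym)
open import Data.List.Relation.Binary.Permutation.Propositional.Properties using (∷↭∷ʳ)
import Data.List.Relation.Binary.Permutation.Setoid.Properties as Permutation
open import Data.List.Relation.Unary.All using (All; []; _∷_)
import Data.List.Relation.Unary.All as All
open import Data.List.Relation.Unary.All.Properties using (++⁻ˡ; ¬Any⇒All¬)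
open import Data.List.Relation.Unary.Any using (here; there)
open import Data.List.Relation.Unary.Unique.Propositional using (Unique; []; _∷_)
import Data.List.Relation.Unary.Unique.Propositional.Properties as Unique
open import Data.Nat using (suc; _+_; _∸_; _<_; s≤s; z≤n)
open import Data.Nat.Properties using (+-suc; +-assoc; +-comm; +-identityʳ; +-cancelˡ-≡; m<m+n; <-irrefl)
open import Data.Product using (Σ; ∃; ∃₂; _×_; _,_; proj₁; proj₂)
open import Data.Sum using (inj₁; inj₂)
open import Relation.Binary.Definitions using (DecidableEquality)
open import Relation.Binary.PropositionalEquality
  using (_≡_; _≢_; refl; sym; trans; cong; cong₂; subst; subst₂; setoid; ≢-sym; module ≡-Reasoning)
open import Relation.Nullary using (¬_; yes; no)

module _ {A : Set} where

  unique-++⁻ˡ : ∀ (xs : List A) {ys} → Unique (xs ++ ys) → Unique xs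
  unique-++⁻ˡ []       _          = []
  unique-++⁻ˡ (x ∷ xs) (x∉ ∷ xs!) = ++⁻ˡ xs x∉ ∷ unique-++⁻ˡ xs xs!

  unique-++⁻ʳ : ∀ (xs : List A) {ys} → Unique (xs ++ ys) → Unique ys
  unique-++⁻ʳ []       xs!       = xs!
  unique-++⁻ʳ (x ∷ xs) (_ ∷ xs!) = unique-++⁻ʳ xs xs!

  open Permutation (setoid A) using (Unique-resp-↭)

  unique-∷⇒∷ʳ : ∀ {x : A} {xs} → Unique (x ∷ xs) → Unique (xs ∷ʳ x)
  unique-∷⇒∷ʳ {x} {xs} = Unique-resp-↭ (↭⇒↭ₛ (∷↭∷ʳ x xs))

  unique-∷ʳ⇒∷ : ∀ {x : A} {xs} → Unique (xs ∷ʳ x) → Unique (x ∷ xs)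
  unique-∷ʳ⇒∷ {x} {xs} = Unique-resp-↭ (↭⇒↭ₛ (↭-sym (∷↭∷ʳ x xs)))

  unique⇒lookup-injective : ∀ {xs : List A} → Unique xs →
    ∀ i j → lookup xs i ≡ lookup xs j → i ≡ j
  unique⇒lookup-injective {_ ∷ _} _          zero    zero    _  = refl
  unique⇒lookup-injective {_ ∷ _} (x∉ ∷ _)   zero    (suc j) eq = ⊥-elim (All.lookup x∉ (∈-lookup j) eq)
  unique⇒lookup-injective {_ ∷ _} (x∉ ∷ _)   (suc i) zero    eq = ⊥-elim (All.lookup x∉ (∈-lookup i) (sym eq))
  unique⇒lookup-injective {_ ∷ _} (_ ∷ xs!)  (suc i) (suc j) eq = cong suc (unique⇒lookup-injective xs! i j eq)

  lookup-++-∷ : ∀ (xs : List A) {a ys} →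
    Σ (Fin (length (xs ++ a ∷ ys))) λ i → toℕ i ≡ length xs × lookup (xs ++ a ∷ ys) i ≡ a
  lookup-++-∷ []       = zero , refl , refl
  lookup-++-∷ (x ∷ xs) with lookup-++-∷ xs
  ... | i , i≡ , lookup≡ = suc i , cong suc i≡ , lookup≡

  lookup-++-∷-++-∷ : ∀ (xs : List A) {a ys b zs} → let L = xs ++ a ∷ ys ++ b ∷ zs in
    Σ (Fin (length L)) λ i → Σ (Fin (length L)) λ j →
      toℕ i ≡ length xs × toℕ j ≡ length xs + suc (length ys) × lookup L i ≡ a × lookup L j ≡ b
  lookup-++-∷-++-∷ [] {ys = ys} with lookup-++-∷ ys
  ... | j , j≡ , lookupʲ≡ = zero , suc j , refl , cong suc j≡ , refl , lookupʲ≡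
  lookup-++-∷-++-∷ (x ∷ xs) with lookup-++-∷-++-∷ xs
  ... | i , j , i≡ , j≡ , lookupⁱ≡ , lookupʲ≡ =
    suc i , suc j , cong suc i≡ , cong suc j≡ , lookupⁱ≡ , lookupʲ≡

  length-∷ʳ : ∀ (xs : List A) {x} → length (xs ∷ʳ x) ≡ suc (length xs)
  length-∷ʳ xs = trans (length-++ xs) (+-comm (length xs) 1)

  length-++-∷-++-∷ : ∀ (xs : List A) {a ys b zs} →
    length (xs ++ a ∷ ys ++ b ∷ zs) ∸ 1 ≡ (length xs + suc (length ys)) + length zs
  length-++-∷-++-∷ xs {a} {ys} {b} {zs} = begin
    length (xs ++ a ∷ ys ++ b ∷ zs) ∸ 1                  ≡⟨ cong (_∸ 1) (length-++ xs) ⟩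
    (length xs + suc (length (ys ++ b ∷ zs))) ∸ 1        ≡⟨ cong (λ n → (length xs + suc n) ∸ 1) (length-++ ys) ⟩
    (length xs + suc (length ys + suc (length zs))) ∸ 1  ≡⟨ cong (_∸ 1) (+-suc (length xs) _) ⟩
    length xs + (length ys + suc (length zs))            ≡⟨ cong (length xs +_) (+-suc (length ys) _) ⟩
    length xs + suc (length ys + length zs)              ≡⟨ sym (+-assoc (length xs) (suc (length ys)) _) ⟩
    (length xs + suc (length ys)) + length zs            ∎
    where open ≡-Reasoning

  length≡0⇒[] : ∀ (xs : List A) → length xs ≡ 0 → xs ≡ []
  length≡0⇒[] [] _ = refl

  map≡[]⇒[] : ∀ {B : Set} (f : A → B) xs → map f xs ≡ [] → xs ≡ []
  map≡[]⇒[] f [] _ = refl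

  ∷ʳ-as-∷ : ∀ (xs : List A) x → ∃₂ λ y ys → xs ∷ʳ x ≡ y ∷ ys
  ∷ʳ-as-∷ []       x = x , [] , refl
  ∷ʳ-as-∷ (y ∷ xs) x = y , xs ∷ʳ x , refl

  reverse-++-∷ : ∀ (xs : List A) x ys → reverse (xs ++ x ∷ ys) ≡ reverse ys ++ x ∷ reverse xs
  reverse-++-∷ xs x ys = begin
    reverse (xs ++ x ∷ ys)             ≡⟨ reverse-++ xs (x ∷ ys) ⟩
    reverse (x ∷ ys) ++ reverse xs     ≡⟨ cong (_++ reverse xs) (unfold-reverse x ys) ⟩
    (reverse ys ∷ʳ x) ++ reverse xs    ≡⟨ ∷ʳ-++ (reverse ys) x (reverse xs) ⟩
    reverse ys ++ x ∷ reverse xs       ∎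
    where open ≡-Reasoning

  reverse-≡ : ∀ {xs ys : List A} → reverse xs ≡ ys → xs ≡ reverse ys
  reverse-≡ {xs} eq = trans (sym (reverse-involutive xs)) (cong reverse eq)

  data PrefixView (xs ys : List A) : Set where
    longer  : ∀ zs → xs ≡ ys ++ zs → PrefixView xs ys
    diverge : ∀ pre x xs′ y ys′ → x ≢ y → xs ≡ pre ++ x ∷ xs′ → ys ≡ pre ++ y ∷ ys′ → PrefixView xs ys
    shorter : ∀ z zs → ys ≡ xs ++ z ∷ zs → PrefixView xs ys

  prefixView : DecidableEquality A → ∀ xs ys → PrefixView xs ys
  prefixView _≟_ xs       []       = longer xs refl
  prefixView _≟_ []       (y ∷ ys) = shorter y ys refl
  prefixView _≟_ (x ∷ xs) (y ∷ ys) with x ≟ y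
  ... | no x≢y = diverge [] x xs y ys x≢y refl refl
  ... | yes refl with prefixView _≟_ xs ys
  ...   | longer zs eq = longer zs (cong (x ∷_) eq)
  ...   | diverge pre x′ xs′ y′ ys′ x′≢y′ eq₁ eq₂ =
          diverge (x ∷ pre) x′ xs′ y′ ys′ x′≢y′ (cong (x ∷_) eq₁) (cong (x ∷_) eq₂)
  ...   | shorter z zs eq = shorter z zs (cong (x ∷_) eq)

  data SuffixView (xs ys : List A) : Set where
    longer  : ∀ zs → xs ≡ zs ++ ys → SuffixView xs ys
    diverge : ∀ xs′ x ys′ y suf → x ≢ y → xs ≡ xs′ ++ x ∷ suf → ys ≡ ys′ ++ y ∷ suf → SuffixView xs ys
    shorter : ∀ zs z → ys ≡ zs ++ z ∷ xs → SuffixView xs ys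

  suffixView : DecidableEquality A → ∀ xs ys → SuffixView xs ys
  suffixView _≟_ xs ys with prefixView _≟_ (reverse xs) (reverse ys)
  ... | longer zs eq = longer (reverse zs) (trans (reverse-≡ eq)
        (trans (reverse-++ (reverse ys) zs) (cong (reverse zs ++_) (reverse-involutive ys))))
  ... | diverge pre x xs′ y ys′ x≢y eq₁ eq₂ =
        diverge (reverse xs′) x (reverse ys′) y (reverse pre) x≢y
          (trans (reverse-≡ eq₁) (reverse-++-∷ pre x xs′)) (trans (reverse-≡ eq₂) (reverse-++-∷ pre y ys′))
  ... | shorter z zs eq = shorter (reverse zs) z (trans (reverse-≡ eq)
        (trans (reverse-++-∷ (reverse xs) z zs) (cong (λ l → reverse zs ++ z ∷ l) (reverse-involutive xs))))

  unique⇒other-element : DecidableEquality A → ∀ {xs} → Unique xs → 1 < length xs →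
    (x : A) → ∃ λ y → y ∈ xs × y ≢ x
  unique⇒other-element _≟_ {y ∷ z ∷ _} ((y≢z ∷ _) ∷ _) _ x with y ≟ x
  ... | no  y≢x  = y , here refl , y≢x
  ... | yes refl = z , there (here refl) , ≢-sym y≢z
  unique⇒other-element _≟_ {_ ∷ []} _ (s≤s ()) _

module _ (G : Graph) where
  open Graph G
  open import Data.List.Membership.DecPropositional (_≟_ {nV}) using (_∈?_)

  private
    variable
      s s′ m w w′ : Node G
      e a c : Arc G
      es xs ys pre rest : List (Arc G)

  data Walk : Node G → List (Arc G) → Node G → Set where
    nil  : Walk s [] s
    cons : ∀ e → t e ≡ s → Walk (h e) es w → Walk s (e ∷ es) w

  walk-++ : Walk s xs m → Walk m ys w → Walk s (xs ++ ys) w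
  walk-++ nil           q = q
  walk-++ (cons e te p) q = cons e te (walk-++ p q)

  walk-++⁻ : ∀ xs → Walk s (xs ++ ys) w → ∃ λ m → Walk s xs m × Walk m ys w
  walk-++⁻ []       p = _ , nil , p
  walk-++⁻ (x ∷ xs) (cons .x tx p) with walk-++⁻ xs p
  ... | m , p₁ , p₂ = m , cons x tx p₁ , p₂

  walk-target-unique : Walk s xs w → Walk s xs w′ → w ≡ w′
  walk-target-unique nil          nil           = refl
  walk-target-unique (cons e _ p) (cons .e _ q) = walk-target-unique p q

  walk-source-unique : Walk s xs w → Walk s′ xs w → s ≡ s′
  walk-source-unique nil           nil             = refl
  walk-source-unique (cons e te _) (cons .e te′ _) = trans (sym te) te′

  walk⇒isWalk : Walk s (e ∷ es) w → IsWalk G (e ∷ es) × t e ≡ s × h (lastArc G e es) ≡ w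
  walk⇒isWalk (cons e te nil) = _ , te , refl
  walk⇒isWalk (cons e te (cons e′ te′ p)) with walk⇒isWalk (cons e′ te′ p)
  ... | isWalk , _ , last = (sym te′ , isWalk) , te , last

  isWalk⇒walk : ∀ e es → IsWalk G (e ∷ es) → Walk (t e) (e ∷ es) (h (lastArc G e es))
  isWalk⇒walk e []        _              = cons e refl nil
  isWalk⇒walk e (e′ ∷ es) (he≡ , isWalk) = cons e refl
    (subst (λ v → Walk v (e′ ∷ es) (h (lastArc G e′ es))) (sym he≡) (isWalk⇒walk e′ es isWalk))

  isWalk⇒interior-walk : ∀ a xs b → IsWalk G (a ∷ xs ++ b ∷ []) → Walk (h a) xs (t b)
  isWalk⇒interior-walk a []       b (ha≡ , _)      = subst (Walk (h a) []) ha≡ nil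
  isWalk⇒interior-walk a (x ∷ xs) b (ha≡ , isWalk) =
    cons x (sym ha≡) (isWalk⇒interior-walk x xs b isWalk)

  reachable⇒walk : Reachable G s w → ∃ λ xs → Walk s xs w
  reachable⇒walk (inj₁ refl)                            = [] , nil
  reachable⇒walk (inj₂ (e , es , isWalk , refl , refl)) = e ∷ es , isWalk⇒walk e es isWalk

  nodes-∷ʳ : Walk s xs w → s ∷ map h xs ≡ map t xs ∷ʳ w
  nodes-∷ʳ nil          = refl
  nodes-∷ʳ (cons e te p) = cong₂ _∷_ (sym te) (nodes-∷ʳ p)

  walk-from-visited : Walk s xs w → Unique (s ∷ map h xs) → s′ ∈ s ∷ map h xs →
    ∃ λ ys → Walk s′ ys w × Unique (s′ ∷ map h ys)
  walk-from-visited p            nodes!       (here refl) = _ , p , nodes!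
  walk-from-visited (cons e _ p) (_ ∷ nodes!) (there s′∈) = walk-from-visited p nodes! s′∈

  shortcut : Walk s xs w → ∃ λ ys → Walk s ys w × Unique (s ∷ map h ys)
  shortcut nil = [] , nil , [] ∷ []
  shortcut {s} (cons e te p) with shortcut p
  ... | ys , q , nodes! with s ∈? h e ∷ map h ys
  ...   | yes s∈ = walk-from-visited q nodes! s∈
  ...   | no  s∉ = e ∷ ys , cons e te q , ¬Any⇒All¬ _ s∉ ∷ nodes!

  -- The tails (heads) of a walk are its nodes without the last (first) one, so a nonempty
  -- simple walk repeats at most its first node, as its last one.
  Simple : List (Arc G) → Set
  Simple xs = Unique (map t xs) × Unique (map h xs)

  simple-++⁻ˡ : ∀ xs → Simple (xs ++ ys) → Simple xs
  simple-++⁻ˡ {ys} xs (tails! , heads!) =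
    unique-++⁻ˡ (map t xs) (subst Unique (map-++ t xs ys) tails!) ,
    unique-++⁻ˡ (map h xs) (subst Unique (map-++ h xs ys) heads!)

  simple-++⁻ʳ : ∀ xs → Simple (xs ++ ys) → Simple ys
  simple-++⁻ʳ {ys} xs (tails! , heads!) =
    unique-++⁻ʳ (map t xs) (subst Unique (map-++ t xs ys) tails!) ,
    unique-++⁻ʳ (map h xs) (subst Unique (map-++ h xs ys) heads!)

  simple-close-after : Walk s xs w → Unique (s ∷ map h xs) → t e ≡ w → h e ≡ s → Simple (xs ∷ʳ e)
  simple-close-after {s} {xs} {w} {e} p nodes! te he =
    subst Unique (sym tails) nodes! , subst Unique (sym heads) (unique-∷⇒∷ʳ nodes!)
    where
    tails : map t (xs ∷ʳ e) ≡ s ∷ map h xs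
    tails = trans (map-++ t xs (e ∷ [])) (trans (cong (λ v → map t xs ∷ʳ v) te) (sym (nodes-∷ʳ p)))
    heads : map h (xs ∷ʳ e) ≡ map h xs ∷ʳ s
    heads = trans (map-++ h xs (e ∷ [])) (cong (λ v → map h xs ∷ʳ v) he)

  simple-close-before : Walk s xs w → Unique (s ∷ map h xs) → t e ≡ w → h e ≡ s → Simple (e ∷ xs)
  simple-close-before {s} {xs} {w} {e} p nodes! te he =
    subst (λ v → Unique (v ∷ map t xs)) (sym te) (unique-∷ʳ⇒∷ (subst Unique (nodes-∷ʳ p) nodes!)) ,
    subst (λ v → Unique (v ∷ map h xs)) (sym he) nodes!

  distinctExceptEnds-∷-∷ʳ : ∀ {x y} zs → Unique (x ∷ zs) → Unique (zs ∷ʳ y) →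
    DistinctExceptEnds G (x ∷ zs ∷ʳ y)
  distinctExceptEnds-∷-∷ʳ _ _ _ zero    zero    () _
  distinctExceptEnds-∷-∷ʳ _ _ _ (suc i) zero    () _
  distinctExceptEnds-∷-∷ʳ _ _ tail! (suc i) (suc j) (s≤s i<j) eq =
    ⊥-elim (<-irrefl (cong toℕ (unique⇒lookup-injective tail! i j eq)) i<j)
  -- x ∉ zs, so x can only recur as y, and y occurs in zs ∷ʳ y at the end only.
  distinctExceptEnds-∷-∷ʳ {x} {y} zs (x∉zs ∷ _) tail! zero (suc j) _ x≡ʲ
    with ∈-++⁻ zs (subst (_∈ zs ∷ʳ y) (sym x≡ʲ) (∈-lookup j))
  ... | inj₁ x∈zs        = ⊥-elim (All.lookup x∉zs x∈zs refl)
  ... | inj₂ (here refl) with lookup-++-∷ zs {x} {[]}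
  ...   | k , k≡ , lookupᵏ≡ = refl , trans (cong suc (trans (cong toℕ j≡k) k≡)) (sym (length-∷ʳ zs))
    where j≡k = unique⇒lookup-injective tail! j k (trans (sym x≡ʲ) (sym lookupᵏ≡))

  distinctExceptEnds-repeat : ∀ p {x} q r → DistinctExceptEnds G (p ++ x ∷ q ++ x ∷ r) →
    p ≡ [] × r ≡ []
  distinctExceptEnds-repeat p q r dee =
    let (i , j , i≡ , j≡ , lookupⁱ≡ , lookupʲ≡) = lookup-++-∷-++-∷ p {ys = q} {zs = r}
        i<j = subst₂ _<_ (sym i≡) (sym j≡) (m<m+n (length p) (s≤s z≤n))
        (i≡0 , j≡last) = dee i j i<j (trans lookupⁱ≡ (sym lookupʲ≡))
        n = length p + suc (length q)
    in length≡0⇒[] p (trans (sym i≡) i≡0) ,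
       length≡0⇒[] r (+-cancelˡ-≡ n (length r) 0
         (trans (sym (length-++-∷-++-∷ p)) (trans (sym j≡last) (trans j≡ (sym (+-identityʳ n))))))

  simple-walk⇒isPath : Walk s (e ∷ es) w → Simple (e ∷ es) → IsPath G (e ∷ es)
  simple-walk⇒isPath {e = e} {es} {w} p (tails! , heads!) =
    proj₁ (walk⇒isWalk p) ,
    subst (λ ns → DistinctExceptEnds G (t e ∷ ns)) (sym heads)
      (distinctExceptEnds-∷-∷ʳ (map t es) tails! (subst Unique heads heads!))
    where
    heads : map h (e ∷ es) ≡ map t es ∷ʳ w
    heads = ∷-injectiveʳ (nodes-∷ʳ p)

  isPath⇒distinct-nodes : Walk s xs w → IsPath G xs → DistinctExceptEnds G (s ∷ map h xs)
  isPath⇒distinct-nodes nil             _         zero zero ()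
  isPath⇒distinct-nodes (cons e refl _) (_ , dee) = dee

  closed-subwalk-of-path : Walk s xs m → Walk m (c ∷ es) m → Walk m ys w →
    IsPath G (xs ++ c ∷ es ++ ys) → xs ≡ [] × ys ≡ []
  closed-subwalk-of-path {s} {xs} {m} {c} {es} {ys} p cycle q isPath =
    let (tails≡[] , heads≡[]) = distinctExceptEnds-repeat (map t xs) (map t es) (map h ys)
          (subst (DistinctExceptEnds G) nodes≡
            (isPath⇒distinct-nodes (walk-++ p (walk-++ cycle q)) isPath))
    in map≡[]⇒[] t xs tails≡[] , map≡[]⇒[] h ys heads≡[]
    where
    open ≡-Reasoning
    nodes≡ : s ∷ map h (xs ++ c ∷ es ++ ys) ≡ map t xs ++ m ∷ map t es ++ m ∷ map h ys
    nodes≡ = begin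
      s ∷ map h (xs ++ c ∷ es ++ ys)
        ≡⟨ cong (s ∷_) (map-++ h xs (c ∷ es ++ ys)) ⟩
      (s ∷ map h xs) ++ map h (c ∷ es ++ ys)
        ≡⟨ cong (_++ map h (c ∷ es ++ ys)) (nodes-∷ʳ p) ⟩
      (map t xs ∷ʳ m) ++ map h (c ∷ es ++ ys)
        ≡⟨ ∷ʳ-++ (map t xs) m _ ⟩
      map t xs ++ m ∷ map h ((c ∷ es) ++ ys)
        ≡⟨ cong (λ l → map t xs ++ m ∷ l) (map-++ h (c ∷ es) ys) ⟩
      map t xs ++ m ∷ map h (c ∷ es) ++ map h ys
        ≡⟨ cong (λ l → map t xs ++ m ∷ l ++ map h ys) (∷-injectiveʳ (nodes-∷ʳ cycle)) ⟩
      map t xs ++ m ∷ (map t es ∷ʳ m) ++ map h ys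
        ≡⟨ cong (λ l → map t xs ++ m ∷ l) (∷ʳ-++ (map t es) m (map h ys)) ⟩
      map t xs ++ m ∷ map t es ++ m ∷ map h ys
        ∎

  PathWithEnds : Node G → Node G → Arc G → Arc G → Set
  PathWithEnds s w a b = ∃ λ es → Walk s (a ∷ es) w × IsPath G (a ∷ es) × lastArc G a es ≡ b

  avoiding : ∀ {b x y} → PathWithEnds s w a b → a ≢ x → b ≢ y → AvoidingPath G s w x y
  avoiding {a = a} (es , p , isPath , refl) a≢x b≢y with walk⇒isWalk p
  ... | _ , refl , last = a , es , isPath , refl , last , a≢x , b≢y

  lastArc-++-∷ : ∀ a pre c rest → lastArc G a (pre ++ c ∷ rest) ≡ lastArc G c rest
  lastArc-++-∷ a []        c rest = refl
  lastArc-++-∷ a (p ∷ pre) c rest = lastArc-++-∷ p pre c rest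

  lastArc-suffix : ∀ pre → a ∷ xs ≡ pre ++ c ∷ rest → lastArc G c rest ≡ lastArc G a xs
  lastArc-suffix []                      refl = refl
  lastArc-suffix {c = c} {rest} (p ∷ pre) refl = sym (lastArc-++-∷ p pre c rest)

  suffix-path : Walk s xs w → Simple xs → xs ≡ pre ++ c ∷ rest → Walk s pre m →
    PathWithEnds m w c (lastArc G c rest)
  suffix-path {pre = pre} {c} {rest} p simple refl q with walk-++⁻ pre p
  ... | _ , q′ , r = rest , r′ , simple-walk⇒isPath r′ (simple-++⁻ʳ pre simple) , refl
    where r′ = subst (λ v → Walk v (c ∷ rest) _) (walk-target-unique q′ q) r

  prefix-path : Walk s (a ∷ xs) w → Simple (a ∷ xs) → xs ≡ pre ++ ys → Walk m ys w →
    PathWithEnds s m a (lastArc G a pre)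
  prefix-path {a = a} {pre = pre} p simple refl q with walk-++⁻ (a ∷ pre) p
  ... | _ , p′ , r = pre , p″ , simple-walk⇒isPath p″ (simple-++⁻ˡ (a ∷ pre) simple) , refl
    where p″ = subst (Walk _ (a ∷ pre)) (walk-source-unique r q) p′

  omnitig-no-bypass : ∀ xs {a ys b zs} → IsOmnitig G (xs ++ a ∷ ys ++ b ∷ zs) →
    ¬ AvoidingPath G (t b) (h a) b a
  omnitig-no-bypass xs {ys = ys} (_ , no-bypass) bypass =
    let (i , j , i≡ , j≡ , lookupⁱ≡ , lookupʲ≡) = lookup-++-∷-++-∷ xs {ys = ys}
    in no-bypass i j (subst₂ _<_ (sym i≡) (sym j≡) (m<m+n (length xs) (s≤s z≤n)))
         (subst₂ (λ x y → AvoidingPath G (t y) (h x) y x) (sym lookupⁱ≡) (sym lookupʲ≡) bypass)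

  omnitig-ends-unlinked : ∀ {f g W b} → IsOmnitig G (f ∷ W ++ g ∷ []) →
    PathWithEnds (t g) (h f) a b → a ≢ g → b ≢ f → ⊥
  omnitig-ends-unlinked om path a≢g b≢f = omnitig-no-bypass [] om (avoiding path a≢g b≢f)

  sibling : (k : Arc G → Node G) (x : Arc G) →
    1 < length (filter (λ e → k e ≟ k x) (allFin nE)) → ∃ λ y → y ≢ x × k y ≡ k x
  sibling k x many
    with unique⇒other-element _≟_ (Unique.filter⁺ (λ e → k e ≟ k x) (Unique.allFin⁺ nE)) many x
  ... | y , y∈ , y≢x = y , y≢x , proj₂ (∈-filter⁻ (λ e → k e ≟ k x) {xs = allFin nE} y∈)

  SimpleClosedWalk : Node G → List (Arc G) → Set
  SimpleClosedWalk u cs = Walk u cs u × Simple cs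

  join-cycle : StronglyConnected G → ∀ {f} → JoinArc G f →
    ∃₂ λ c cs → SimpleClosedWalk (h f) (c ∷ cs) × lastArc G c cs ≢ f
  join-cycle sc {f} join with sibling h f join
  ... | f₂ , f₂≢f , hf₂≡ with reachable⇒walk (sc (h f) (t f₂))
  ... | _ , p with shortcut p
  ... | P , q , nodes! with ∷ʳ-as-∷ P f₂
  ... | c , cs , P∷ʳf₂≡ =
    c , cs ,
    subst (SimpleClosedWalk (h f)) P∷ʳf₂≡
      (walk-++ q (cons f₂ refl (subst (Walk (h f₂) []) hf₂≡ nil)) , simple-close-after q nodes! refl hf₂≡) ,
    λ last≡f → f₂≢f (trans (lastArc-suffix P (sym P∷ʳf₂≡)) last≡f)

  split-cycle : StronglyConnected G → ∀ {g} → SplitArc G g →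
    ∃₂ λ c cs → SimpleClosedWalk (t g) (c ∷ cs) × c ≢ g
  split-cycle sc {g} split with sibling t g split
  ... | g₂ , g₂≢g , tg₂≡ with reachable⇒walk (sc (h g₂) (t g))
  ... | _ , p with shortcut p
  ... | Q , q , nodes! = g₂ , Q , (cons g₂ tg₂≡ q , simple-close-before q nodes! tg₂≡ refl) , g₂≢g

  join-return-path : ∀ {f g W c cs} → IsOmnitig G (f ∷ W ++ g ∷ []) → IsPath G W →
    SimpleClosedWalk (h f) (c ∷ cs) → lastArc G c cs ≢ f →
    ∃ λ c′ → PathWithEnds (t g) (h f) c′ (lastArc G c cs)
  join-return-path {f} {g} {W} {c} {cs} om isPath (cycle , simple) last≢f =
    go (prefixView _≟_ (c ∷ cs) W)
    where
    walkW : Walk (h f) W (t g)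
    walkW = isWalk⇒interior-walk f W g (proj₁ om)

    back : ∀ pre {c′ rest m} → c ∷ cs ≡ pre ++ c′ ∷ rest → Walk (h f) pre m →
      PathWithEnds m (h f) c′ (lastArc G c cs)
    back pre eq q =
      let (es , p , isPath′ , last≡) = suffix-path cycle simple eq q
      in es , p , isPath′ , trans last≡ (lastArc-suffix pre eq)

    go : PrefixView (c ∷ cs) W → ∃ λ c′ → PathWithEnds (t g) (h f) c′ (lastArc G c cs)
    go (longer [] eq) =
      c , subst (λ v → PathWithEnds v (h f) c (lastArc G c cs)) u≡v (back [] refl nil)
      where
      u≡v : h f ≡ t g
      u≡v = walk-target-unique
        (subst (λ l → Walk (h f) l (h f)) (trans eq (++-identityʳ W)) cycle) walkW
    go (longer (c′ ∷ rest) eq) = c′ , back W eq walkW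
    go (diverge pre c′ rest e ws c′≢e eq₁ eq₂)
      with walk-++⁻ pre (subst (λ l → Walk (h f) l (t g)) eq₂ walkW)
    ... | _ , q , cons .e te _ =
      ⊥-elim (omnitig-no-bypass [] {ys = pre} (subst (λ l → IsOmnitig G (f ∷ l)) W++g≡ om)
        (avoiding (subst (λ v → PathWithEnds v (h f) c′ (lastArc G c cs)) (sym te) (back pre eq₁ q))
          c′≢e last≢f))
      where
      W++g≡ : W ++ g ∷ [] ≡ pre ++ e ∷ ws ++ g ∷ []
      W++g≡ = trans (cong (_++ g ∷ []) eq₂) (++-assoc pre (e ∷ ws) (g ∷ []))
    go (shorter z zs eq)
      with walk-++⁻ (c ∷ cs) (subst (λ l → Walk (h f) l (t g)) eq walkW)
    ... | _ , q₁ , q₂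
      with closed-subwalk-of-path nil cycle
             (subst (λ v → Walk v (z ∷ zs) (t g)) (walk-target-unique q₁ cycle) q₂) (subst (IsPath G) eq isPath)
    ... | _ , ()

  split-return-path : ∀ {f g W c cs} → IsOmnitig G (f ∷ W ++ g ∷ []) → IsPath G W →
    SimpleClosedWalk (t g) (c ∷ cs) → c ≢ g →
    ∃ λ ℓ → PathWithEnds (t g) (h f) c ℓ
  split-return-path {f} {g} {W} {c} {cs} om isPath (cycle , simple) c≢g =
    go (suffixView _≟_ (c ∷ cs) W)
    where
    walkW : Walk (h f) W (t g)
    walkW = isWalk⇒interior-walk f W g (proj₁ om)

    W≡ : ∀ {zs z} → W ≡ zs ++ z ∷ c ∷ cs → W ≡ (zs ∷ʳ z) ++ c ∷ cs
    W≡ {zs} {z} eq = trans eq (sym (∷ʳ-++ zs z (c ∷ cs)))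

    go : SuffixView (c ∷ cs) W → ∃ λ ℓ → PathWithEnds (t g) (h f) c ℓ
    go (longer [] eq) =
      _ , subst (λ v → PathWithEnds (t g) v c (lastArc G c cs)) (sym u≡v)
            (prefix-path cycle simple (sym (++-identityʳ cs)) nil)
      where
      u≡v : h f ≡ t g
      u≡v = walk-source-unique walkW (subst (λ l → Walk (t g) l (t g)) eq cycle)
    go (longer (z ∷ zs) eq) = _ , prefix-path cycle simple (∷-injectiveʳ eq) walkW
    go (diverge xs′ c′ ws e suf c′≢e eq₁ eq₂) with ∷ʳ-as-∷ xs′ c′
    ... | a , ys , xs′∷ʳc′≡
      with walk-++⁻ ws (subst (λ l → Walk (h f) l (t g)) eq₂ walkW)
    ... | _ , _ , cons .e _ r =
      ⊥-elim (omnitig-no-bypass (f ∷ ws) {ys = suf} (subst (λ l → IsOmnitig G (f ∷ l)) W++g≡ om)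
        (avoiding (prefix-path cycle simple (∷-injectiveʳ D≡) r) c≢g
          (λ last≡e → c′≢e (trans c′≡last last≡e))))
      where
      D≡ : c ∷ cs ≡ (a ∷ ys) ++ suf
      D≡ = trans eq₁ (trans (sym (∷ʳ-++ xs′ c′ suf)) (cong (_++ suf) xs′∷ʳc′≡))
      c′≡last : c′ ≡ lastArc G c ys
      c′≡last = trans (lastArc-suffix xs′ (sym xs′∷ʳc′≡))
        (cong (λ x → lastArc G x ys) (sym (∷-injectiveˡ D≡)))
      W++g≡ : W ++ g ∷ [] ≡ ws ++ e ∷ suf ++ g ∷ []
      W++g≡ = trans (cong (_++ g ∷ []) eq₂) (++-assoc ws (e ∷ suf) (g ∷ []))
    go (shorter zs z eq) with walk-++⁻ (zs ∷ʳ z) (subst (λ l → Walk (h f) l (t g)) (W≡ eq) walkW)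
    ... | _ , q₁ , q₂
      with closed-subwalk-of-path (subst (Walk (h f) (zs ∷ʳ z)) (walk-source-unique q₂ cycle) q₁) cycle nil
             (subst (IsPath G) (trans (W≡ eq) (cong (λ l → (zs ∷ʳ z) ++ c ∷ l) (sym (++-identityʳ cs))))
               isPath)
    ... | zs∷ʳz≡[] , _ with ++-conicalʳ zs (z ∷ []) zs∷ʳz≡[]
    ... | ()

  join-omnitig-last-arc-unique : StronglyConnected G → ∀ {f g g′ W} → JoinArc G f → IsPath G W →
    IsOmnitig G (f ∷ W ++ g ∷ []) → g′ ≢ g → t g′ ≡ t g → ¬ IsOmnitig G (f ∷ W ++ g′ ∷ [])
  join-omnitig-last-arc-unique sc {f} {g} join isPath om g′≢g tg′≡ om′ with join-cycle sc join
  ... | c , cs , cycle , last≢f with join-return-path om isPath cycle last≢f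
  ... | c′ , path with c′ ≟ g
  ...   | yes refl = omnitig-ends-unlinked om′
                       (subst (λ v → PathWithEnds v (h f) c′ (lastArc G c cs)) (sym tg′≡) path) (≢-sym g′≢g) last≢f
  ...   | no c′≢g  = omnitig-ends-unlinked om path c′≢g last≢f

  split-omnitig-first-arc-unique : StronglyConnected G → ∀ {f f′ g W} → SplitArc G g → IsPath G W →
    IsOmnitig G (f ∷ W ++ g ∷ []) → f′ ≢ f → h f′ ≡ h f → ¬ IsOmnitig G (f′ ∷ W ++ g ∷ [])
  split-omnitig-first-arc-unique sc {f} {f′} {g} split isPath om f′≢f hf′≡ om′
    with split-cycle sc split
  ... | c , cs , cycle , c≢g with split-return-path om isPath cycle c≢g
  ... | ℓ , path with ℓ ≟ f
  ...   | yes refl = omnitig-ends-unlinked om′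
                       (subst (λ v → PathWithEnds (t g) v c ℓ) (sym hf′≡) path) c≢g (≢-sym f′≢f)
  ...   | no ℓ≢f   = omnitig-ends-unlinked om path c≢g ℓ≢f

corollary17 : (G : Graph) → StronglyConnected G → Compressed G → ¬ IsClosedPath G →
    (f g : Arc G) (W : List (Arc G)) →
    IsOmnitig G (f ∷ W ++ g ∷ []) → JoinArc G f → SplitArc G g →
    ((IsPath G W × All (JoinFree G) W) →
       (g' : Arc G) → SplitArc G g' → g' ≢ g → Graph.t G g' ≡ Graph.t G g →
       ¬ IsOmnitig G (f ∷ W ++ g' ∷ []))
    × ((IsPath G W × All (SplitFree G) W) →
       (f' : Arc G) → JoinArc G f' → f' ≢ f → Graph.h G f' ≡ Graph.h G f →
       ¬ IsOmnitig G (f' ∷ W ++ g ∷ []))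
corollary17 G sc _ _ f g W om join split =
  (λ (isPath , _) g′ _ g′≢g tg′≡ → join-omnitig-last-arc-unique G sc join isPath om g′≢g tg′≡) ,
  (λ (isPath , _) f′ _ f′≢f hf′≡ → split-omnitig-first-arc-unique G sc split isPath om f′≢f hf′≡)
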